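{- Fix nonnegative integers $k$ and $\ell$. Then \[\max_{\lambda \in H(k,\ell;n)} h_{1,1}(\lambda)\, r_\lambda \in \Theta(n^{k+\ell+1}).\]
   Context: For a partition $\lambda\vdash n$ with conjugate $\lambda'$, let $h_{1,1}(\lambda)=\lambda_1+\lambda'_1-1$ be the $(1,1)$ hook length of $\lambda$. Let $r_\lambda$ denote the number of partitions $\alpha$ (including the empty partition and $\lambda$ itself) whose Young diagram is contained in the Young diagram of $\lambda$, i.e. $r_\lambda=\#\{\alpha \mid \alpha\subseteq\lambda\}$. The $(k,\ell)$ hook is the infinite shape $\{(i,j)\mid i\le k \text{ or } j\le \ell\}$, and $H(k,\ell;n)=\{\lambda\vdash n \mid \lambda_{k+1}\le \ell\}$ is the set of partitions of $n$ whose Young diagram lies inside the $(k,\ell)$ hook. The asymptotics are as $n\to\infty$ with $k,\ell$ fixed. -}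

module Defs where

open import Data.Nat using (ℕ; zero; suc; _+_; _*_; _∸_; _^_; _≤_)
open import Data.List using (List; []; _∷_; length)
open import Data.Nat.ListAction using (sum)
open import Relation.Binary.PropositionalEquality using (_≡_)
open import Data.List.Relation.Unary.All using (All)
open import Data.List.Relation.Unary.Linked using (Linked)
open import Data.Product using (Σ; _×_)
open import Data.Fin using (Fin)
open import Function.Bundles using (_↔_)

IsPartition : List ℕ → Set
IsPartition λs = Linked (λ a b → b ≤ a) λs × All (λ a → 1 ≤ a) λs

IsPartitionOf : ℕ → List ℕ → Set
IsPartitionOf n λs = IsPartition λs × sum λs ≡ n

-- part λs i = λ_{i+1} (0-indexed), with λ_j = 0 beyond the length.
part : List ℕ → ℕ → ℕ
part []       _       = 0
part (a ∷ _)  zero    = a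
part (_ ∷ as) (suc i) = part as i

data _⊆ᴾ_ : List ℕ → List ℕ → Set where
  []⊆  : ∀ {μ} → [] ⊆ᴾ μ
  ∷⊆∷  : ∀ {a b α μ} → a ≤ b → α ⊆ᴾ μ → (a ∷ α) ⊆ᴾ (b ∷ μ)

Sub : List ℕ → Set
Sub λs = Σ (List ℕ) (λ α → IsPartition α × α ⊆ᴾ λs)

-- r_λ = m  :⇔  #{α ⊆ λ} = m, i.e. Fin m is in bijection with Sub λ.
HasSubCount : List ℕ → ℕ → Set
HasSubCount λs m = Fin m ↔ Sub λs

-- h_{1,1}(λ) = λ₁ + λ'₁ − 1, where λ'₁ = number of parts.
h11 : List ℕ → ℕ
h11 λs = part λs 0 + length λs ∸ 1

-- λ ∈ H(k,ℓ;n)  :⇔  λ ⊢ n and λ_{k+1} ≤ ℓ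
InHook : ℕ → ℕ → ℕ → List ℕ → Set
InHook k ℓ n λs = IsPartitionOf n λs × part λs k ≤ ℓ

-- A sub-diagram of a partition λ in the (k, ℓ) hook is determined by its first k row
-- lengths and its first ℓ column heights, all at most n = |λ|, so r_λ ≤ (n+1)^(k+ℓ); with
-- h₁₁(λ) ≤ n this is the upper bound. For the lower bound write n = r + qM with r < M and
-- let λ be k rows of length (k+1)q (the first lengthened by r; when k = 0, r single boxes
-- at the bottom instead) above an ℓq × ℓ rectangle. Letting the long rows vary in windows
-- of q+1 lengths, and the i-th column of the rectangle end anywhere in its i-th band of q
-- rows, gives (q+1)^(k+ℓ) sub-diagrams, while h₁₁(λ) ≥ q ≥ n/M − 1.
-- Sub-diagrams are counted by recursion on the first row,
-- count u (b ∷ μ) = 1 + Σ_{a=1}^{u⊓b} count a μ, which is realised as a bijection with Fin.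

module Submission where

open import Defs
open import Data.Nat using (ℕ; zero; suc; _+_; _*_; _^_; _∸_; _≤_; _<_; _⊓_; z≤n; s≤s; NonZero)
open import Data.Nat.DivMod using (_/_; _%_; m≡m%n+[m/n]*n; m%n<n; m*n/n≡m; /-monoˡ-≤)
open import Data.Nat.Properties
open import Data.List using (List; []; _∷_; length; replicate; _++_)
open import Data.List.Properties using (length-++; length-replicate)
open import Data.List.Relation.Unary.All as All using (All; []; _∷_)
open import Data.List.Relation.Unary.Linked as Linked using (Linked; []; [-]; _∷_)
open import Data.Fin using (Fin)
open import Data.Fin.Properties using (0↔⊥; 1↔⊤; +↔⊎)
open import Data.Fin.Permutation using (↔⇒≡)
open import Data.Product using (Σ; _×_; _,_; proj₂)
open import Data.Sum using (_⊎_; inj₁; inj₂)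
open import Data.Sum.Function.Propositional using (_⊎-↔_)
open import Data.Unit using (⊤; tt)
open import Data.Empty using (⊥; ⊥-elim)
open import Function.Bundles using (_↔_; mk↔ₛ′)
open import Function.Properties.Inverse using (↔-sym; ↔-trans)
open import Relation.Binary.PropositionalEquality
open import Data.Nat.ListAction using (sum)
open import Data.Nat.ListAction.Properties using (sum-++)
open import Data.Nat.Tactic.RingSolver using (solve-∀)

-- Counting sub-diagrams

data Below : ℕ → List ℕ → List ℕ → Set where
  []   : ∀ {u μ} → Below u μ []
  cons : ∀ {u a b μ α} → 1 ≤ a → a ≤ u → a ≤ b → Below a μ α → Below u (b ∷ μ) (a ∷ α)

Below-irrelevant : ∀ {u μ α} (p q : Below u μ α) → p ≡ q
Below-irrelevant [] [] = refl
Below-irrelevant (cons p q r s) (cons p′ q′ r′ s′)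
  rewrite ≤-irrelevant p p′ | ≤-irrelevant q q′ | ≤-irrelevant r r′ | Below-irrelevant s s′ = refl

Subs : ℕ → List ℕ → Set
Subs u μ = Σ (List ℕ) (Below u μ)

-- The nonempty elements of Subs m (b ∷ μ) for b ≥ m, split by their first part a.
Subs⁺ : ℕ → List ℕ → Set
Subs⁺ m μ = Σ ℕ λ a → (1 ≤ a × a ≤ m) × Subs a μ

mutual
  count : ℕ → List ℕ → ℕ
  count u []      = 1
  count u (b ∷ μ) = suc (count⁺ (u ⊓ b) μ)

  count⁺ : ℕ → List ℕ → ℕ
  count⁺ zero    μ = 0
  count⁺ (suc m) μ = count⁺ m μ + count (suc m) μ

Subs-[]-↔ : ∀ {u} → Subs u [] ↔ ⊤
Subs-[]-↔ = mk↔ₛ′ _ (λ _ → [] , []) (λ _ → refl) λ { ([] , []) → refl }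

Subs-∷-↔ : ∀ {u b μ} → Subs u (b ∷ μ) ↔ (⊤ ⊎ Subs⁺ (u ⊓ b) μ)
Subs-∷-↔ {u} {b} {μ} = mk↔ₛ′ to from to∘from from∘to
  where
  to : Subs u (b ∷ μ) → ⊤ ⊎ Subs⁺ (u ⊓ b) μ
  to ([] , [])                = inj₁ tt
  to (a ∷ α , cons p q r α≤) = inj₂ (a , (p , ⊓-glb q r) , α , α≤)
  from : ⊤ ⊎ Subs⁺ (u ⊓ b) μ → Subs u (b ∷ μ)
  from (inj₁ _)                      = [] , []
  from (inj₂ (a , (p , q) , α , α≤)) =
    a ∷ α , cons p (≤-trans q (m⊓n≤m u b)) (≤-trans q (m⊓n≤n u b)) α≤
  to∘from : ∀ x → to (from x) ≡ x
  to∘from (inj₁ _)                      = refl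
  to∘from (inj₂ (a , (p , q) , α , α≤)) =
    cong (λ q′ → inj₂ (a , (p , q′) , α , α≤)) (≤-irrelevant _ q)
  from∘to : ∀ x → from (to x) ≡ x
  from∘to ([] , [])                = refl
  from∘to (a ∷ α , cons p q r α≤) = cong (a ∷ α ,_) (Below-irrelevant _ _)

Subs⁺-zero-↔ : ∀ {μ} → Subs⁺ 0 μ ↔ ⊥
Subs⁺-zero-↔ = mk↔ₛ′ (λ { (_ , (() , z≤n) , _) }) (λ ()) (λ ()) (λ { (_ , (() , z≤n) , _) })

Subs⁺-suc-↔ : ∀ {m μ} → Subs⁺ (suc m) μ ↔ (Subs⁺ m μ ⊎ Subs (suc m) μ)
Subs⁺-suc-↔ {m} {μ} = mk↔ₛ′ to from to∘from from∘to
  where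
  split : ∀ {a} → 1 ≤ a → Subs a μ → a < suc m ⊎ a ≡ suc m → Subs⁺ m μ ⊎ Subs (suc m) μ
  split p α (inj₁ (s≤s a≤m)) = inj₁ (_ , (p , a≤m) , α)
  split p α (inj₂ refl)      = inj₂ α
  to : Subs⁺ (suc m) μ → Subs⁺ m μ ⊎ Subs (suc m) μ
  to (a , (p , q) , α) = split p α (m≤n⇒m<n∨m≡n q)
  from : Subs⁺ m μ ⊎ Subs (suc m) μ → Subs⁺ (suc m) μ
  from (inj₁ (a , (p , q) , α)) = a , (p , m≤n⇒m≤1+n q) , α
  from (inj₂ α)                 = suc m , (s≤s z≤n , ≤-refl) , α
  to∘from : ∀ x → to (from x) ≡ x
  to∘from (inj₁ (a , (p , q) , α)) = split-< (m≤n⇒m<n∨m≡n (m≤n⇒m≤1+n q))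
    where
    split-< : ∀ e → split p α e ≡ inj₁ (a , (p , q) , α)
    split-< (inj₁ (s≤s q′)) = cong (λ q″ → inj₁ (a , (p , q″) , α)) (≤-irrelevant q′ q)
    split-< (inj₂ refl)     = ⊥-elim (1+n≰n q)
  to∘from (inj₂ α) = split-≡ (m≤n⇒m<n∨m≡n ≤-refl)
    where
    split-≡ : ∀ e → split (s≤s z≤n) α e ≡ inj₂ α
    split-≡ (inj₁ (s≤s m<m)) = ⊥-elim (1+n≰n m<m)
    split-≡ (inj₂ refl)      = refl
  from∘to : ∀ x → from (to x) ≡ x
  from∘to (a , (p , q) , α) = from-split (m≤n⇒m<n∨m≡n q)
    where
    from-split : ∀ e → from (split p α e) ≡ (a , (p , q) , α)
    from-split (inj₁ (s≤s _)) = cong (λ q′ → a , (p , q′) , α) (≤-irrelevant _ q)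
    from-split (inj₂ refl)    = cong₂ (λ p′ q′ → a , (p′ , q′) , α) (≤-irrelevant _ p) (≤-irrelevant _ q)

mutual
  count-↔ : ∀ u μ → Fin (count u μ) ↔ Subs u μ
  count-↔ u []      = ↔-trans 1↔⊤ (↔-sym Subs-[]-↔)
  count-↔ u (b ∷ μ) = ↔-trans (+↔⊎ {1}) (↔-trans (1↔⊤ ⊎-↔ count⁺-↔ (u ⊓ b) μ) (↔-sym Subs-∷-↔))

  count⁺-↔ : ∀ m μ → Fin (count⁺ m μ) ↔ Subs⁺ m μ
  count⁺-↔ zero    μ = ↔-trans 0↔⊥ (↔-sym Subs⁺-zero-↔)
  count⁺-↔ (suc m) μ =
    ↔-trans +↔⊎ (↔-trans (count⁺-↔ m μ ⊎-↔ count-↔ (suc m) μ) (↔-sym Subs⁺-suc-↔))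

Linked-head : ∀ {a α} → Linked (λ x y → y ≤ x) (a ∷ α) → part α 0 ≤ a
Linked-head [-]     = z≤n
Linked-head (p ∷ _) = p

Linked-irrelevant : ∀ {α} (p q : Linked (λ x y → y ≤ x) α) → p ≡ q
Linked-irrelevant []      []      = refl
Linked-irrelevant [-]     [-]     = refl
Linked-irrelevant (p ∷ s) (q ∷ t) = cong₂ _∷_ (≤-irrelevant p q) (Linked-irrelevant s t)

⊆ᴾ-irrelevant : ∀ {α μ} (p q : α ⊆ᴾ μ) → p ≡ q
⊆ᴾ-irrelevant []⊆       []⊆       = refl
⊆ᴾ-irrelevant (∷⊆∷ p s) (∷⊆∷ q t) = cong₂ ∷⊆∷ (≤-irrelevant p q) (⊆ᴾ-irrelevant s t)

⊆ᴾ-refl : ∀ {μ} → μ ⊆ᴾ μ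
⊆ᴾ-refl {[]}    = []⊆
⊆ᴾ-refl {_ ∷ _} = ∷⊆∷ ≤-refl ⊆ᴾ-refl

⊆ᴾ-head : ∀ {α μ} → α ⊆ᴾ μ → part α 0 ≤ part μ 0
⊆ᴾ-head []⊆       = z≤n
⊆ᴾ-head (∷⊆∷ p _) = p

toBelow : ∀ {u μ α} → IsPartition α → α ⊆ᴾ μ → part α 0 ≤ u → Below u μ α
toBelow _            []⊆           _   = []
toBelow (L , p ∷ ps) (∷⊆∷ a≤b α⊆μ) a≤u =
  cons p a≤u a≤b (toBelow (Linked.tail L , ps) α⊆μ (Linked-head L))

Below-isPartition : ∀ {u μ α} → Below u μ α → IsPartition α
Below-isPartition []                                = [] , []
Below-isPartition (cons p _ _ [])                   = [-] , p ∷ []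
Below-isPartition (cons p _ _ α@(cons _ a′≤a _ _)) =
  let L , ps = Below-isPartition α in a′≤a ∷ L , p ∷ ps

Below-⊆ᴾ : ∀ {u μ α} → Below u μ α → α ⊆ᴾ μ
Below-⊆ᴾ []             = []⊆
Below-⊆ᴾ (cons _ _ r α) = ∷⊆∷ r (Below-⊆ᴾ α)

Below-head : ∀ {u μ α} → Below u μ α → part α 0 ≤ u
Below-head []             = z≤n
Below-head (cons _ q _ _) = q

Below-weaken : ∀ {u u′ μ α} → u ≤ u′ → Below u μ α → Below u′ μ α
Below-weaken _    []             = []
Below-weaken u≤u′ (cons p q r α) = cons p (≤-trans q u≤u′) r α

Sub-↔ : ∀ λs → Sub λs ↔ Subs (part λs 0) λs
Sub-↔ λs = mk↔ₛ′ to from to∘from from∘to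
  where
  to : Sub λs → Subs (part λs 0) λs
  to (α , π , α⊆λ) = α , toBelow π α⊆λ (⊆ᴾ-head α⊆λ)
  from : Subs (part λs 0) λs → Sub λs
  from (α , α≤) = α , Below-isPartition α≤ , Below-⊆ᴾ α≤
  to∘from : ∀ x → to (from x) ≡ x
  to∘from (α , _) = cong (α ,_) (Below-irrelevant _ _)
  from∘to : ∀ x → from (to x) ≡ x
  from∘to (α , (L , ps) , α⊆λ) = cong (α ,_) (cong₂ _,_
    (cong₂ _,_ (Linked-irrelevant _ L) (All.irrelevant ≤-irrelevant _ ps))
    (⊆ᴾ-irrelevant _ α⊆λ))

subCount : List ℕ → ℕ
subCount λs = count (part λs 0) λs

subCount-correct : ∀ λs → HasSubCount λs (subCount λs)
subCount-correct λs = ↔-trans (count-↔ (part λs 0) λs) (↔-sym (Sub-↔ λs))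

HasSubCount-unique : ∀ {λs m} → HasSubCount λs m → m ≡ subCount λs
HasSubCount-unique {λs} e = ↔⇒≡ (↔-trans e (↔-sym (subCount-correct λs)))

-- Monotonicity and the upper bound

count-zero : ∀ μ → count 0 μ ≡ 1
count-zero []      = refl
count-zero (_ ∷ _) = refl

count-positive : ∀ u μ → 1 ≤ count u μ
count-positive u []      = ≤-refl
count-positive u (_ ∷ _) = s≤s z≤n

count⁺-mono : ∀ μ {m m′} → m ≤ m′ → count⁺ m μ ≤ count⁺ m′ μ
count⁺-mono μ {m′ = zero}  z≤n = ≤-refl
count⁺-mono μ {m′ = suc m′} m≤ with m≤n⇒m<n∨m≡n m≤
... | inj₁ (s≤s m≤m′) = ≤-trans (count⁺-mono μ m≤m′) (m≤m+n _ _)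
... | inj₂ refl        = ≤-refl

count-mono : ∀ μ {u u′} → u ≤ u′ → count u μ ≤ count u′ μ
count-mono []      _    = ≤-refl
count-mono (b ∷ μ) u≤u′ = s≤s (count⁺-mono μ (⊓-monoˡ-≤ b u≤u′))

mutual
  count-mono-⊆ᴾ : ∀ u {μ ν} → μ ⊆ᴾ ν → count u μ ≤ count u ν
  count-mono-⊆ᴾ u {ν = ν} []⊆ = count-positive u ν
  count-mono-⊆ᴾ u (∷⊆∷ {b = b} a≤b μ⊆ν) =
    s≤s (≤-trans (count⁺-mono _ (⊓-monoʳ-≤ u a≤b)) (count⁺-mono-⊆ᴾ (u ⊓ b) μ⊆ν))

  count⁺-mono-⊆ᴾ : ∀ m {μ ν} → μ ⊆ᴾ ν → count⁺ m μ ≤ count⁺ m ν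
  count⁺-mono-⊆ᴾ zero    _   = z≤n
  count⁺-mono-⊆ᴾ (suc m) μ⊆ν = +-mono-≤ (count⁺-mono-⊆ᴾ m μ⊆ν) (count-mono-⊆ᴾ (suc m) μ⊆ν)

count-saturates : ∀ {ℓ} u μ → part μ 0 ≤ ℓ → count u μ ≤ count ℓ μ
count-saturates u []      _   = ≤-refl
count-saturates u (b ∷ μ) b≤ℓ =
  s≤s (count⁺-mono μ (⊓-glb (≤-trans (m⊓n≤n u b) b≤ℓ) (m⊓n≤n u b)))

count≤subCount : ∀ u λs → count u λs ≤ subCount λs
count≤subCount u λs = count-saturates u λs ≤-refl

count⁺-≤ : ∀ μ {m m′} → m ≤ m′ → count⁺ m μ ≤ m * count m′ μ
count⁺-≤ μ {zero}  _    = z≤n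
count⁺-≤ μ {suc m} {m′} m≤m′ = ≤-trans
  (+-mono-≤ (count⁺-≤ μ (≤-trans (n≤1+n m) m≤m′)) (count-mono μ m≤m′))
  (≤-reflexive (+-comm (m * count m′ μ) (count m′ μ)))

count-∷-≤ : ∀ u b μ → count u (b ∷ μ) ≤ suc b * count u μ
count-∷-≤ u b μ = +-mono-≤ (count-positive u μ)
  (≤-trans (count⁺-≤ μ (m⊓n≤m u b)) (*-monoˡ-≤ (count u μ) (m⊓n≤n u b)))

count-suc-∷ : ∀ a b μ → count (suc a) (b ∷ μ) ≤ count a (b ∷ μ) + count (suc a) μ
count-suc-∷ a zero    μ = s≤s z≤n
count-suc-∷ a (suc b) μ = s≤s (+-mono-≤
  (count⁺-mono μ (⊓-monoʳ-≤ a (n≤1+n b))) (count-mono μ (s≤s (m⊓n≤m a b))))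

count-≤-length^ : ∀ a μ → count a μ ≤ suc (length μ) ^ a
count-≤-length^ zero    μ       = ≤-reflexive (count-zero μ)
count-≤-length^ (suc a) []      = m^n>0 1 (suc a)
count-≤-length^ (suc a) (b ∷ μ) = ≤-trans (count-suc-∷ a b μ) (+-mono-≤
  (count-≤-length^ a (b ∷ μ))
  (≤-trans (count-≤-length^ (suc a) μ) (*-monoʳ-≤ (suc (length μ)) (^-monoˡ-≤ a (n≤1+n _)))))

count-hook-≤ : ∀ {ℓ n} j u λs → All (_≤ n) λs → length λs ≤ n → part λs j ≤ ℓ →
  count u λs ≤ suc n ^ (j + ℓ)
count-hook-≤ {ℓ} {n} zero u λs _ len≤n hook = ≤-trans (count-saturates u λs hook)
  (≤-trans (count-≤-length^ ℓ λs) (^-monoˡ-≤ ℓ (s≤s len≤n)))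
count-hook-≤ {ℓ} {n} (suc j) u []      _          _     _    = m^n>0 (suc n) (suc j + ℓ)
count-hook-≤ (suc j) u (b ∷ μ) (b≤n ∷ μ≤n) len≤n hook = ≤-trans (count-∷-≤ u b μ)
  (*-mono-≤ (s≤s b≤n) (count-hook-≤ j u μ μ≤n (≤-trans (n≤1+n _) len≤n) hook))

parts≤sum : ∀ λs → All (_≤ sum λs) λs
parts≤sum []      = []
parts≤sum (b ∷ μ) = m≤m+n b (sum μ) ∷ All.map (λ a≤ → ≤-trans a≤ (m≤n+m (sum μ) b)) (parts≤sum μ)

length≤sum : ∀ {λs} → All (1 ≤_) λs → length λs ≤ sum λs
length≤sum []       = z≤n
length≤sum (p ∷ ps) = +-mono-≤ p (length≤sum ps)

h11≤sum : ∀ {λs} → All (1 ≤_) λs → h11 λs ≤ sum λs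
h11≤sum          []       = z≤n
h11≤sum {b ∷ μ} (_ ∷ ps) = ≤-trans (≤-reflexive (cong (_∸ 1) (+-suc b (length μ))))
  (+-monoʳ-≤ b (length≤sum ps))

suc≤2* : ∀ {n} → 1 ≤ n → suc n ≤ 2 * n
suc≤2* {n} 1≤n = ≤-trans (+-monoˡ-≤ n 1≤n) (≤-reflexive (cong (n +_) (sym (+-identityʳ n))))

^-distribʳ-* : ∀ m n o → (m * n) ^ o ≡ m ^ o * n ^ o
^-distribʳ-* m n zero    = refl
^-distribʳ-* m n (suc o) = trans (cong (m * n *_) (^-distribʳ-* m n o)) (lemma m n (m ^ o) (n ^ o))
  where
  lemma : ∀ m n x y → m * n * (x * y) ≡ m * x * (n * y)
  lemma = solve-∀

subCount-hook-≤ : ∀ {k ℓ n λs} → InHook k ℓ n λs → subCount λs ≤ suc n ^ (k + ℓ)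
subCount-hook-≤ {k} {λs = λs} (((_ , ps) , refl) , hook) =
  count-hook-≤ k (part λs 0) λs (parts≤sum λs) (length≤sum ps) hook

h11*subCount-≤ : ∀ {k ℓ n λs m} → 1 ≤ n → InHook k ℓ n λs → HasSubCount λs m →
  h11 λs * m ≤ 2 ^ (k + ℓ) * n ^ (k + ℓ + 1)
h11*subCount-≤ {k} {ℓ} {n} {λs} {m} 1≤n inHook@(((_ , ps) , refl) , _) e = begin
  h11 λs * m                 ≡⟨ cong (h11 λs *_) (HasSubCount-unique e) ⟩
  h11 λs * subCount λs       ≤⟨ *-mono-≤ (h11≤sum ps) (subCount-hook-≤ inHook) ⟩
  n * suc n ^ d              ≤⟨ *-monoʳ-≤ n (^-monoˡ-≤ d (suc≤2* 1≤n)) ⟩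
  n * (2 * n) ^ d            ≡⟨ cong (n *_) (^-distribʳ-* 2 n d) ⟩
  n * (2 ^ d * n ^ d)        ≡⟨ lemma n (2 ^ d) (n ^ d) ⟩
  2 ^ d * (n ^ d * n ^ 1)    ≡⟨ cong (2 ^ d *_) (^-distribˡ-+-* n d 1) ⟨
  2 ^ d * n ^ (d + 1)        ∎
  where
  open ≤-Reasoning
  d = k + ℓ
  lemma : ∀ n x y → n * (x * y) ≡ x * (y * (n * 1))
  lemma = solve-∀

-- The lower bound

count≤suc-count⁺ : ∀ ρ v → count v ρ ≤ suc (count⁺ v ρ)
count≤suc-count⁺ ρ zero    = ≤-reflexive (count-zero ρ)
count≤suc-count⁺ ρ (suc v) = m≤n⇒m≤1+n (m≤n+m (count (suc v) ρ) (count⁺ v ρ))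

count⁺-≥ : ∀ ρ t v → suc t * count v ρ ≤ suc (count⁺ (t + v) ρ)
count⁺-≥ ρ zero    v = ≤-trans (≤-reflexive (+-identityʳ _)) (count≤suc-count⁺ ρ v)
count⁺-≥ ρ (suc t) v = ≤-trans (≤-reflexive (+-comm (count v ρ) (suc t * count v ρ)))
  (+-mono-≤ (count⁺-≥ ρ t v) (count-mono ρ (m≤n⇒m≤1+n (m≤n+m v t))))

count-∷-≥ : ∀ {t v u b} ρ → t + v ≤ u → t + v ≤ b → suc t * count v ρ ≤ count u (b ∷ ρ)
count-∷-≥ {t} {v} ρ ≤u ≤b = ≤-trans (count⁺-≥ ρ t v) (s≤s (count⁺-mono ρ (⊓-glb ≤u ≤b)))

count-mono-∷ : ∀ {c b} ρ → c ≤ b → count c ρ ≤ count c (b ∷ ρ)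
count-mono-∷ {c} ρ c≤b = ≤-trans (count≤suc-count⁺ ρ c) (s≤s (count⁺-mono ρ (⊓-glb ≤-refl c≤b)))

count-mono-replicate : ∀ {c x} t ρ → c ≤ x → count c ρ ≤ count c (replicate t x ++ ρ)
count-mono-replicate zero    ρ _   = ≤-refl
count-mono-replicate (suc t) ρ c≤x =
  ≤-trans (count-mono-replicate t ρ c≤x) (count-mono-∷ (replicate t _ ++ ρ) c≤x)

count-rows-≥ : ∀ {q v x} j ρ → j * q + v ≤ x →
  suc q ^ j * count v ρ ≤ count (j * q + v) (replicate j x ++ ρ)
count-rows-≥ zero ρ _ = ≤-reflexive (+-identityʳ _)
count-rows-≥ {q} {v} {x} (suc j) ρ ≤x = begin
  suc q ^ suc j * count v ρ                         ≡⟨ *-assoc (suc q) (suc q ^ j) (count v ρ) ⟩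
  suc q * (suc q ^ j * count v ρ)                   ≤⟨ *-monoʳ-≤ (suc q) (count-rows-≥ j ρ (≤-trans (m≤n+m _ q) next≤x)) ⟩
  suc q * count (j * q + v) (replicate j x ++ ρ)    ≤⟨ count-∷-≥ {t = q} (replicate j x ++ ρ) reassoc next≤x ⟩
  count (suc j * q + v) (replicate (suc j) x ++ ρ)  ∎
  where
  open ≤-Reasoning
  reassoc : q + (j * q + v) ≤ suc j * q + v
  reassoc = ≤-reflexive (sym (+-assoc q (j * q) v))
  next≤x : q + (j * q + v) ≤ x
  next≤x = ≤-trans reassoc ≤x

replicate-+ : ∀ {A : Set} m n (x : A) → replicate (m + n) x ≡ replicate m x ++ replicate n x
replicate-+ zero    n x = refl
replicate-+ (suc m) n x = cong (x ∷_) (replicate-+ m n x)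

count-column-≥ : ∀ {a c} t ρ → suc a ≤ c → suc t * count a ρ ≤ count (suc a) (replicate t c ++ ρ)
count-column-≥ zero    ρ _ = ≤-trans (≤-reflexive (+-identityʳ _)) (count-mono ρ (n≤1+n _))
count-column-≥ {a} {c} (suc t) ρ a<c = ≤-trans
  (+-mono-≤ (≤-trans (count-mono-replicate t ρ (<⇒≤ a<c)) (count≤suc-count⁺ rest a))
            (count-column-≥ t ρ a<c))
  (s≤s (count⁺-mono rest (⊓-glb ≤-refl a<c)))
  where
  rest = replicate t c ++ ρ

count-rectangle-≥ : ∀ {c} a t → a ≤ c → suc t ^ a ≤ count a (replicate (a * t) c)
count-rectangle-≥     zero    t _   = ≤-refl
count-rectangle-≥ {c} (suc a) t a<c = begin
  suc t * suc t ^ a                                     ≤⟨ *-monoʳ-≤ (suc t) (count-rectangle-≥ a t (<⇒≤ a<c)) ⟩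
  suc t * count a (replicate (a * t) c)                 ≤⟨ count-column-≥ t (replicate (a * t) c) a<c ⟩
  count (suc a) (replicate t c ++ replicate (a * t) c)  ≡⟨ cong (count (suc a)) (replicate-+ t (a * t) c) ⟨
  count (suc a) (replicate (suc a * t) c)               ∎
  where
  open ≤-Reasoning

sum-replicate : ∀ t x → sum (replicate t x) ≡ t * x
sum-replicate zero    x = refl
sum-replicate (suc t) x = cong (x +_) (sum-replicate t x)

part-replicate-++ : ∀ j x ys → part (replicate j x ++ ys) j ≡ part ys 0
part-replicate-++ zero    x ys = refl
part-replicate-++ (suc j) x ys = part-replicate-++ j x ys

head≤h11 : ∀ b μ → b ≤ h11 (b ∷ μ)
head≤h11 b μ = ≤-trans (m≤m+n b (length μ)) (≤-reflexive (cong (_∸ 1) (sym (+-suc b (length μ)))))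

length≤h11 : ∀ {λs} → All (1 ≤_) λs → length λs ≤ h11 λs
length≤h11          []      = z≤n
length≤h11 {b ∷ μ} (p ∷ _) = ≤-trans (+-monoˡ-≤ (length μ) p)
  (≤-reflexive (cong (_∸ 1) (sym (+-suc b (length μ)))))

⊆ᴾ-++ : ∀ (xs : List ℕ) {ys} → xs ⊆ᴾ (xs ++ ys)
⊆ᴾ-++ []       = []⊆
⊆ᴾ-++ (_ ∷ xs) = ∷⊆∷ ≤-refl (⊆ᴾ-++ xs)

Below-replicate : ∀ {x u} j → 1 ≤ x → x ≤ u → Below u (replicate j x) (replicate j x)
Below-replicate zero    _   _   = []
Below-replicate (suc j) 1≤x x≤u = cons 1≤x x≤u ≤-refl (Below-replicate j 1≤x ≤-refl)

Below-replicate-++ : ∀ {x u ys} j → 1 ≤ x → x ≤ u → Below x ys ys →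
  Below u (replicate j x ++ ys) (replicate j x ++ ys)
Below-replicate-++ zero    _   x≤u ys≤ = Below-weaken x≤u ys≤
Below-replicate-++ (suc j) 1≤x x≤u ys≤ = cons 1≤x x≤u ≤-refl (Below-replicate-++ j 1≤x ≤-refl ys≤)

Below-rows : ∀ ℓ t → Below ℓ (replicate (ℓ * t) ℓ) (replicate (ℓ * t) ℓ)
Below-rows zero    t = []
Below-rows (suc ℓ) t = Below-replicate (suc ℓ * t) (s≤s z≤n) ≤-refl

LargeHook : ℕ → ℕ → ℕ → ℕ → Set
LargeHook k ℓ n q = Σ (List ℕ) λ λs → InHook k ℓ n λs × q ≤ h11 λs × suc q ^ (k + ℓ) ≤ subCount λs

wide-hook : ∀ k ℓ q r → 1 ≤ q → ℓ ≤ q → LargeHook (suc k) ℓ (r + q * (suc k * suc (suc k) + ℓ * ℓ)) q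
wide-hook k ℓ q r 1≤q ℓ≤q = λs , ((Below-isPartition λs≤ , size) , hook) , q≤h11 , many
  where
  w = suc (suc k) * q
  T = replicate (ℓ * q) ℓ
  λs = (w + r) ∷ replicate k w ++ T
  q≤w : q ≤ w
  q≤w = m≤m+n q (suc k * q)
  λs≤ : Below (w + r) λs λs
  λs≤ = cons (≤-trans 1≤q (≤-trans q≤w (m≤m+n w r))) ≤-refl ≤-refl
    (Below-replicate-++ k (≤-trans 1≤q q≤w) (m≤m+n w r)
      (Below-weaken (≤-trans ℓ≤q q≤w) (Below-rows ℓ q)))
  size : sum λs ≡ r + q * (suc k * suc (suc k) + ℓ * ℓ)
  size = begin
    w + r + sum (replicate k w ++ T)       ≡⟨ cong (w + r +_) (sum-++ (replicate k w) T) ⟩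
    w + r + (sum (replicate k w) + sum T)  ≡⟨ cong₂ (λ x y → w + r + (x + y))
                                                (sum-replicate k w) (sum-replicate (ℓ * q) ℓ) ⟩
    w + r + (k * w + ℓ * q * ℓ)            ≡⟨ lemma k ℓ q r ⟩
    r + q * (suc k * suc (suc k) + ℓ * ℓ)  ∎
    where
    open ≡-Reasoning
    lemma : ∀ k ℓ q r → suc (suc k) * q + r + (k * (suc (suc k) * q) + ℓ * q * ℓ)
                        ≡ r + q * (suc k * suc (suc k) + ℓ * ℓ)
    lemma = solve-∀
  hook : part λs (suc k) ≤ ℓ
  hook = ≤-trans (≤-reflexive (part-replicate-++ k w T)) (Below-head (Below-rows ℓ q))
  q≤h11 : q ≤ h11 λs
  q≤h11 = ≤-trans q≤w (≤-trans (m≤m+n w r) (head≤h11 (w + r) (replicate k w ++ T)))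
  many : suc q ^ (suc k + ℓ) ≤ subCount λs
  many = begin
    suc q ^ (suc k + ℓ)                             ≡⟨ ^-distribˡ-+-* (suc q) (suc k) ℓ ⟩
    suc q ^ suc k * suc q ^ ℓ                       ≤⟨ *-monoʳ-≤ (suc q ^ suc k) (count-rectangle-≥ ℓ q ≤-refl) ⟩
    suc q ^ suc k * count ℓ T                       ≤⟨ count-rows-≥ (suc k) T top ⟩
    count (suc k * q + ℓ) (w ∷ replicate k w ++ T)  ≤⟨ count-mono-⊆ᴾ (suc k * q + ℓ) (∷⊆∷ (m≤m+n w r) ⊆ᴾ-refl) ⟩
    count (suc k * q + ℓ) λs                        ≤⟨ count≤subCount (suc k * q + ℓ) λs ⟩
    subCount λs                                     ∎
    where
    open ≤-Reasoning
    top : suc k * q + ℓ ≤ w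
    top = ≤-trans (+-monoʳ-≤ (suc k * q) ℓ≤q) (≤-reflexive (+-comm (suc k * q) q))

tall-hook : ∀ ℓ q r → 1 ≤ q → LargeHook 0 (suc ℓ) (r + q * (suc ℓ * suc ℓ)) q
tall-hook ℓ q r 1≤q = λs , ((Below-isPartition λs≤ , size) , Below-head λs≤) , q≤h11 , many
  where
  L = suc ℓ
  T = replicate (L * q) L
  λs = T ++ replicate r 1
  λs≤ : Below L λs λs
  λs≤ = Below-replicate-++ (L * q) (s≤s z≤n) ≤-refl (Below-replicate r ≤-refl (s≤s z≤n))
  size : sum λs ≡ r + q * (L * L)
  size = begin
    sum (T ++ replicate r 1)     ≡⟨ sum-++ T (replicate r 1) ⟩
    sum T + sum (replicate r 1)  ≡⟨ cong₂ _+_ (sum-replicate (L * q) L) (sum-replicate r 1) ⟩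
    L * q * L + r * 1            ≡⟨ lemma L q r ⟩
    r + q * (L * L)              ∎
    where
    open ≡-Reasoning
    lemma : ∀ L q r → L * q * L + r * 1 ≡ r + q * (L * L)
    lemma = solve-∀
  q≤h11 : q ≤ h11 λs
  q≤h11 = begin
    q                                  ≤⟨ m≤m+n q (ℓ * q) ⟩
    L * q                              ≡⟨ length-replicate (L * q) ⟨
    length T                           ≤⟨ m≤m+n (length T) (length (replicate r 1)) ⟩
    length T + length (replicate r 1)  ≡⟨ length-++ T ⟨
    length λs                          ≤⟨ length≤h11 (proj₂ (Below-isPartition λs≤)) ⟩
    h11 λs                             ∎
    where
    open ≤-Reasoning
  many : suc q ^ L ≤ subCount λs
  many = ≤-trans (count-rectangle-≥ L q ≤-refl)
    (≤-trans (count-mono-⊆ᴾ L (⊆ᴾ-++ T)) (count≤subCount L λs))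

quotient-power-≤ : ∀ {n M q h m} d → n ≤ suc q * M → 1 ≤ q → q ≤ h → suc q ^ d ≤ m →
  n ^ (d + 1) ≤ 2 * M ^ (d + 1) * (h * m)
quotient-power-≤ {n} {M} {q} {h} {m} d n≤ 1≤q q≤h many = begin
  n ^ (d + 1)                           ≤⟨ ^-monoˡ-≤ (d + 1) n≤ ⟩
  (suc q * M) ^ (d + 1)                 ≡⟨ ^-distribʳ-* (suc q) M (d + 1) ⟩
  suc q ^ (d + 1) * M ^ (d + 1)         ≡⟨ cong (λ e → suc q ^ e * M ^ (d + 1)) (+-comm d 1) ⟩
  suc q * suc q ^ d * M ^ (d + 1)       ≤⟨ *-monoˡ-≤ (M ^ (d + 1)) (*-mono-≤ suc-q≤2h many) ⟩
  2 * h * m * M ^ (d + 1)               ≡⟨ lemma h m (M ^ (d + 1)) ⟩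
  2 * M ^ (d + 1) * (h * m)             ∎
  where
  open ≤-Reasoning
  suc-q≤2h : suc q ≤ 2 * h
  suc-q≤2h = ≤-trans (suc≤2* 1≤q) (*-monoʳ-≤ 2 q≤h)
  lemma : ∀ h m x → 2 * h * m * x ≡ 2 * x * (h * m)
  lemma = solve-∀

HookBounds : ℕ → ℕ → Set
HookBounds k ℓ = Σ ℕ λ c → Σ ℕ λ C → Σ ℕ λ N → (n : ℕ) → N ≤ n →
  ((λs : List ℕ) → InHook k ℓ n λs → (m : ℕ) → HasSubCount λs m →
     h11 λs * m ≤ C * n ^ (k + ℓ + 1))
  × (Σ (List ℕ) λ λs → InHook k ℓ n λs × Σ ℕ λ m → HasSubCount λs m ×
     n ^ (k + ℓ + 1) ≤ c * (h11 λs * m))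

hook-bounds : ∀ k ℓ M .{{_ : NonZero M}} → (∀ q r → suc ℓ ≤ q → LargeHook k ℓ (r + q * M) q) →
  HookBounds k ℓ
hook-bounds k ℓ M large = 2 * M ^ (k + ℓ + 1) , 2 ^ (k + ℓ) , suc (suc ℓ * M) , λ n N≤n →
  (λ _ inHook _ e → h11*subCount-≤ (≤-trans (s≤s z≤n) N≤n) inHook e) ,
  lower n (≤-trans (n≤1+n _) N≤n)
  where
  Witnessed : ℕ → Set
  Witnessed n = Σ (List ℕ) λ λs → InHook k ℓ n λs × Σ ℕ λ m → HasSubCount λs m ×
    n ^ (k + ℓ + 1) ≤ 2 * M ^ (k + ℓ + 1) * (h11 λs * m)
  witnessed : ∀ {n q} → n ≤ suc q * M → 1 ≤ q → LargeHook k ℓ n q → Witnessed n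
  witnessed n≤ 1≤q (λs , inHook , q≤h11 , many) =
    λs , inHook , subCount λs , subCount-correct λs , quotient-power-≤ (k + ℓ) n≤ 1≤q q≤h11 many
  lower : ∀ n → suc ℓ * M ≤ n → Witnessed n
  lower n N≤n =
    witnessed n≤ (≤-trans (s≤s z≤n) ℓ<q) (subst (λ n′ → LargeHook k ℓ n′ q) (sym n≡) (large q r ℓ<q))
    where
    q = n / M
    r = n % M
    n≡ : n ≡ r + q * M
    n≡ = m≡m%n+[m/n]*n n M
    ℓ<q : suc ℓ ≤ q
    ℓ<q = ≤-trans (≤-reflexive (sym (m*n/n≡m (suc ℓ) M))) (/-monoˡ-≤ M N≤n)
    n≤ : n ≤ suc q * M
    n≤ = ≤-trans (≤-reflexive n≡) (+-monoˡ-≤ (q * M) (<⇒≤ (m%n<n n M)))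

proposition5 : (k ℓ : ℕ) → 1 ≤ k + ℓ →
    Σ ℕ λ c → Σ ℕ λ C → Σ ℕ λ N → (n : ℕ) → N ≤ n →
      ((λs : List ℕ) → InHook k ℓ n λs → (m : ℕ) → HasSubCount λs m →
         h11 λs * m ≤ C * n ^ (k + ℓ + 1))
      × (Σ (List ℕ) λ λs → InHook k ℓ n λs × Σ ℕ λ m → HasSubCount λs m ×
         n ^ (k + ℓ + 1) ≤ c * (h11 λs * m))
proposition5 zero    zero    ()
proposition5 zero    (suc ℓ) _ = hook-bounds 0 (suc ℓ) (suc ℓ * suc ℓ)
  λ q r ℓ<q → tall-hook ℓ q r (≤-trans (s≤s z≤n) ℓ<q)
proposition5 (suc k) ℓ       _ = hook-bounds (suc k) ℓ (suc k * suc (suc k) + ℓ * ℓ)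
  λ q r ℓ<q → wide-hook k ℓ q r (≤-trans (s≤s z≤n) ℓ<q) (<⇒≤ ℓ<q)
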